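{- Let $n\ge 2$ be an integer. If $A=\begin{pmatrix}0&b\\c&d\end{pmatrix}$ is a $0$-$1$ matrix such that $b\neq c$, then both $(K_1\oplus_{=} K_1)^n_A$ and $(K_1\oplus_{\neq} K_1)^{n+1}_A$ have vertex-minors isomorphic to $P_n$.
   Context: $P_n$ is the path on $n$ vertices. For two $m$-vertex graphs $G,H$ on disjoint vertex sets with orderings $v_1,\dots,v_m$ and $w_1,\dots,w_m$, $G\oplus_{=}H$ (resp. $G\oplus_{\neq}H$) is the graph on $V(G)\cup V(H)$ inducing $G$ on $V(G)$ and $H$ on $V(H)$, in which $v_iw_j$ is an edge iff $i=j$ (resp. iff $i\neq j$). For $\odot\in\{\oplus_=,\oplus_{\neq}\}$, a positive integer $s$ and a $0$-$1$ matrix $A=\begin{pmatrix}a&b\\c&d\end{pmatrix}$, $(G\odot H)^s_A$ is the disjoint union of $s$ copies of $G\odot H$ with added edges such that for all $1\le i<j\le s$, the $i$-th copy of $G$ is complete (if $a=1$) or anti-complete (if $a=0$) to the $j$-th copy of $G$; likewise with $b$ for ($i$-th $G$, $j$-th $H$), $c$ for ($i$-th $H$, $j$-th $G$), and $d$ for ($i$-th $H$, $j$-th $H$). A vertex-minor of $G$ is an induced subgraph of a graph obtained from $G$ by a sequence of local complementations, where local complementation at $v$ replaces the subgraph induced on $N_G(v)$ by its complement. -}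

module Defs where

open import Data.Nat using (ℕ; zero; suc; _+_; _<ᵇ_; _≡ᵇ_)
open import Data.Fin using (Fin; toℕ)
open import Data.Bool using (Bool; true; false; _∧_; _∨_; _xor_; not; if_then_else_)
open import Data.Sum using (_⊎_; inj₁; inj₂)
open import Data.Product using (_×_; _,_; Σ; ∃)
open import Data.List using (List; []; _∷_)
open import Relation.Binary.PropositionalEquality using (_≡_)
open import Relation.Binary.Definitions using (DecidableEquality)
open import Relation.Nullary.Decidable using (⌊_⌋)
open import Function.Definitions using (Injective)

-- A (simple) graph on a vertex type V, given by its adjacency predicate.
-- All graphs constructed below are symmetric and irreflexive, and local
-- complementation preserves this.
Graph : Set → Set
Graph V = V → V → Bool

localComp : {V : Set} → DecidableEquality V → Graph V → V → Graph V
localComp _≟_ G v x y = G x y xor (G v x ∧ G v y ∧ not ⌊ x ≟ y ⌋)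

localComps : {V : Set} → DecidableEquality V → Graph V → List V → Graph V
localComps _≟_ G [] = G
localComps _≟_ G (v ∷ vs) = localComps _≟_ (localComp _≟_ G v) vs

HasVertexMinorIso : {V W : Set} → DecidableEquality V → Graph V → Graph W → Set
HasVertexMinorIso {V} {W} _≟_ G H =
  Σ (List V) λ vs → Σ (W → V) λ f →
    Injective _≡_ _≡_ f × (∀ x y → H x y ≡ localComps _≟_ G vs (f x) (f y))

P : (n : ℕ) → Graph (Fin n)
P n i j = (suc (toℕ i) ≡ᵇ toℕ j) ∨ (suc (toℕ j) ≡ᵇ toℕ i)

K1 : Graph (Fin 1)
K1 _ _ = false

_==_ : {m : ℕ} → Fin m → Fin m → Bool
i == j = toℕ i ≡ᵇ toℕ j

-- G ⊕ H for m-vertex graphs with vertex orderings Fin m. The flag `eq`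
-- selects ⊕₌ (true: v_i w_j edge iff i = j) or ⊕≠ (false: iff i ≠ j).
-- V(G) = inj₁, V(H) = inj₂.
oplus : {m : ℕ} → Bool → Graph (Fin m) → Graph (Fin m) → Graph (Fin m ⊎ Fin m)
oplus eq G H (inj₁ i) (inj₁ j) = G i j
oplus eq G H (inj₂ i) (inj₂ j) = H i j
oplus eq G H (inj₁ i) (inj₂ j) = if eq then i == j else not (i == j)
oplus eq G H (inj₂ i) (inj₁ j) = if eq then i == j else not (i == j)

oplusEq oplusNeq : {m : ℕ} → Graph (Fin m) → Graph (Fin m) → Graph (Fin m ⊎ Fin m)
oplusEq = oplus true
oplusNeq = oplus false

-- (G ⊙ H)^s_A for A = (a b; c d), given the graph X = G ⊙ H on Fin m ⊎ Fin m.
-- Vertex (k , u): vertex u of the k-th copy.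
sideAdj : {m : ℕ} → (a b c d : Bool) → Fin m ⊎ Fin m → Fin m ⊎ Fin m → Bool
sideAdj a b c d (inj₁ _) (inj₁ _) = a
sideAdj a b c d (inj₁ _) (inj₂ _) = b
sideAdj a b c d (inj₂ _) (inj₁ _) = c
sideAdj a b c d (inj₂ _) (inj₂ _) = d

power : {m : ℕ} → Graph (Fin m ⊎ Fin m) → (s : ℕ) → (a b c d : Bool) →
        Graph (Fin s × (Fin m ⊎ Fin m))
power X s a b c d (k , u) (l , w) =
  if toℕ k ≡ᵇ toℕ l then X u w
  else if toℕ k <ᵇ toℕ l then sideAdj a b c d u w
  else sideAdj a b c d w u

open import Data.Fin.Properties using () renaming (_≟_ to _≟F_)
import Data.Sum.Properties as SumP
import Data.Product.Properties as ProdP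

_≟V_ : {s m : ℕ} → DecidableEquality (Fin s × (Fin m ⊎ Fin m))
_≟V_ = ProdP.≡-dec _≟F_ (SumP.≡-dec _≟F_ _≟F_)

module Submission where

-- Reversing the order of the copies transposes A, so we may take b = 1, c = 0.
-- Both graphs then contain, as an induced subgraph, the half graph on vertices
-- aₖ, bₖ (k < n) with aₖ ~ bₗ iff k ≤ l, in which the bₖ form a clique if d = 1
-- and an independent set if d = 0.  If d = 1, local complementation at a₀
-- removes the clique.  Pivoting (local complementation at u, v, u on an edge uv)
-- successively on a₀b₀, a₁b₁, …, aₙ₋₁bₙ₋₁ then yields the path a₀ b₀ a₁ b₁ … on
-- 2n vertices, whose first n vertices induce Pₙ.  Finally, vertex-minors of an
-- induced subgraph are vertex-minors of the whole graph.

open import Defs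
open import Data.Bool using (Bool; true; false; not; T; _∧_; _∨_; _xor_; if_then_else_)
open import Data.Bool.Properties using (∧-zeroʳ; ∧-identityʳ; xor-identityʳ; xor-same)
import Data.Bool.Properties as Bool
open import Data.Bool.Solver using (module xor-∧-Solver)
open import Data.Empty using (⊥-elim)
open import Data.Sum using (_⊎_; inj₁; inj₂)
open import Data.Nat using (ℕ; zero; suc; _≤_; _<_; _<ᵇ_; _≤ᵇ_; _≡ᵇ_; z≤n; s≤s)
import Data.Nat.Properties as ℕ
open import Data.Fin using (Fin; toℕ; fromℕ<; inject₁; opposite) renaming (zero to fzero; suc to fsuc)
import Data.Fin.Properties as Fin
open import Data.List using (List; []; _∷_; _++_; map; upTo; allFin; tabulate; applyUpTo)
open import Data.List.Properties using (upTo-∷ʳ; map-++; map-tabulate)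
open import Data.Product using (_×_; _,_; proj₁; proj₂; map₁) renaming (map to map-×)
import Data.Product.Properties as ×
open import Function using (_∘_)
open import Function.Bundles using (_⇔_; mk⇔)
open import Function.Definitions using (Injective)
open import Relation.Binary.Definitions using (DecidableEquality; tri<; tri≈; tri>)
open import Relation.Binary.PropositionalEquality
open import Relation.Nullary using (¬_; Dec; yes; no)
open import Relation.Nullary.Decidable using (⌊_⌋; isYes≗does; dec-true; dec-false; does-⇔)

infix 4 _≈_
_≈_ : {V : Set} → Graph V → Graph V → Set
G ≈ H = ∀ x y → G x y ≡ H x y

Symmetric : {V : Set} → Graph V → Set
Symmetric G = ∀ x y → G x y ≡ G y x

module BooleanIdentities where
  open xor-∧-Solver

  xor-cancelˡ : ∀ a b → a xor (b xor a) ≡ b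
  xor-cancelˡ = solve 2 (λ a b → a :+ (b :+ a) := b) refl

  xor-cancelʳ : ∀ a b → (a xor b) xor a ≡ b
  xor-cancelʳ = solve 2 (λ a b → (a :+ b) :+ a := b) refl

  ∧-swap : ∀ a b c → a ∧ (b ∧ c) ≡ b ∧ (a ∧ c)
  ∧-swap = solve 3 (λ a b c → a :* (b :* c) := b :* (a :* c)) refl

  toggle-diag : ∀ a b c → a xor ((b ∧ c) xor (c ∧ b)) ≡ a
  toggle-diag = solve 3 (λ a b c → a :+ ((b :* c) :+ (c :* b)) := a) refl

  -- Three successive local complementations at u, v, u, seen from a pair x, y
  -- outside {u, v}: a = G x y, b = G u x, c = G u y, d = G v x, e = G v y.
  pivot-identity : ∀ a b c d e →
    ((a xor (b ∧ c)) xor ((d xor b) ∧ (e xor c))) xor (d ∧ e) ≡ a xor ((b ∧ e) xor (d ∧ c))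
  pivot-identity = solve 5 (λ a b c d e →
    ((a :+ (b :* c)) :+ ((d :+ b) :* (e :+ c))) :+ (d :* e) := a :+ ((b :* e) :+ (d :* c))) refl

open BooleanIdentities

⌊⌋-true : {A : Set} (a? : Dec A) → A → ⌊ a? ⌋ ≡ true
⌊⌋-true a? a = trans (isYes≗does a?) (dec-true a? a)

⌊⌋-false : {A : Set} (a? : Dec A) → ¬ A → ⌊ a? ⌋ ≡ false
⌊⌋-false a? ¬a = trans (isYes≗does a?) (dec-false a? ¬a)

⌊⌋-⇔ : {A B : Set} → A ⇔ B → (a? : Dec A) (b? : Dec B) → ⌊ a? ⌋ ≡ ⌊ b? ⌋
⌊⌋-⇔ A⇔B a? b? = trans (isYes≗does a?) (trans (does-⇔ A⇔B a? b?) (sym (isYes≗does b?)))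

module LocalComplementation {V : Set} (_≟_ : DecidableEquality V) where

  localComp-cong : {G H : Graph V} → G ≈ H → ∀ w → localComp _≟_ G w ≈ localComp _≟_ H w
  localComp-cong G≈H w x y rewrite G≈H x y | G≈H w x | G≈H w y = refl

  localComps-cong : {G H : Graph V} → G ≈ H → ∀ ws → localComps _≟_ G ws ≈ localComps _≟_ H ws
  localComps-cong G≈H []       = G≈H
  localComps-cong G≈H (w ∷ ws) = localComps-cong (localComp-cong G≈H w) ws

  localComps-++ : ∀ G us ws → localComps _≟_ G (us ++ ws) ≡ localComps _≟_ (localComps _≟_ G us) ws
  localComps-++ G []       ws = refl
  localComps-++ G (u ∷ us) ws = localComps-++ (localComp _≟_ G u) us ws

  localComp-diag : ∀ G w x → localComp _≟_ G w x x ≡ G x x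
  localComp-diag G w x
    rewrite ⌊⌋-true (x ≟ x) refl | ∧-zeroʳ (G w x) | ∧-zeroʳ (G w x) = xor-identityʳ (G x x)

  localComp-off : ∀ G w {x y} → x ≢ y → localComp _≟_ G w x y ≡ G x y xor (G w x ∧ G w y)
  localComp-off G w {x} {y} x≢y rewrite ⌊⌋-false (x ≟ y) x≢y | ∧-identityʳ (G w y) = refl

  localComp-centre : ∀ G w {z} → G w w ≡ false → w ≢ z → localComp _≟_ G w w z ≡ G w z
  localComp-centre G w {z} ww w≢z rewrite localComp-off G w w≢z | ww = xor-identityʳ (G w z)

  localComp-nbr : ∀ G w {x z} → G w x ≡ true → x ≢ z → localComp _≟_ G w x z ≡ G x z xor G w z
  localComp-nbr G w wx x≢z rewrite localComp-off G w x≢z | wx = refl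

  localComp-sym : ∀ {G} → Symmetric G → ∀ w → Symmetric (localComp _≟_ G w)
  localComp-sym {G} symG w x y
    rewrite symG x y | ⌊⌋-⇔ (mk⇔ sym sym) (x ≟ y) (y ≟ x) = cong (G y x xor_) (∧-swap (G w x) (G w y) _)

module InducedSubgraph {V W : Set} (eqV : DecidableEquality V) (eqW : DecidableEquality W)
  (ψ : W → V) (ψ-injective : Injective _≡_ _≡_ ψ) where

  restrict : Graph V → Graph W
  restrict G a b = G (ψ a) (ψ b)

  localComps-restrict : ∀ {G H} → H ≈ restrict G → ∀ ws →
    localComps eqW H ws ≈ restrict (localComps eqV G (map ψ ws))
  localComps-restrict H≈G []       = H≈G
  localComps-restrict {G} {H} H≈G (w ∷ ws) = localComps-restrict step ws
    where
    step : localComp eqW H w ≈ restrict (localComp eqV G (ψ w))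
    step a b rewrite H≈G a b | H≈G w a | H≈G w b
                   | ⌊⌋-⇔ (mk⇔ (cong ψ) ψ-injective) (eqW a b) (eqV (ψ a) (ψ b)) = refl

  vertexMinor-lift : ∀ {G H} → H ≈ restrict G → {U : Set} {K : Graph U} →
    HasVertexMinorIso eqW H K → HasVertexMinorIso eqV G K
  vertexMinor-lift H≈G (ws , f , f-injective , K≡) =
    map ψ ws , ψ ∘ f , f-injective ∘ ψ-injective ,
    λ x y → trans (K≡ x y) (localComps-restrict H≈G ws (f x) (f y))

-- Off {u, v} it toggles the pairs
-- joining N(u) to N(v); the vertices u and v exchange their neighbourhoods.
module Pivot {V : Set} (_≟_ : DecidableEquality V) (G : Graph V) (symG : Symmetric G)
  {u v : V} (u≢v : u ≢ v) (uv : G u v ≡ true) (uu : G u u ≡ false) (vv : G v v ≡ false) where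

  open LocalComplementation _≟_
  open ≡-Reasoning

  G₁ G₂ pivot : Graph V
  G₁    = localComp _≟_ G u
  G₂    = localComp _≟_ G₁ v
  pivot = localComp _≟_ G₂ u

  private
    v≢u : v ≢ u
    v≢u = ≢-sym u≢v

    G₁-vu : G₁ v u ≡ true
    G₁-vu = trans (localComp-nbr G u uv v≢u) (cong₂ _xor_ (trans (symG v u) uv) uu)

    G₁-vv : G₁ v v ≡ false
    G₁-vv = trans (localComp-diag G u v) vv

    G₂-uu : G₂ u u ≡ false
    G₂-uu = trans (localComp-diag G₁ v u) (trans (localComp-diag G u u) uu)

    G₂-uv : G₂ u v ≡ true
    G₂-uv = trans (localComp-nbr G₁ v G₁-vu u≢v)
                  (cong₂ _xor_ (trans (localComp-centre G u uu u≢v) uv) G₁-vv)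

    G₂-u : ∀ {z} → z ≢ u → z ≢ v → G₂ u z ≡ G v z
    G₂-u {z} z≢u z≢v = begin
      G₂ u z                       ≡⟨ localComp-nbr G₁ v G₁-vu (≢-sym z≢u) ⟩
      G₁ u z xor G₁ v z            ≡⟨ cong₂ _xor_ (localComp-centre G u uu (≢-sym z≢u))
                                                  (localComp-nbr G u uv (≢-sym z≢v)) ⟩
      G u z xor (G v z xor G u z)  ≡⟨ xor-cancelˡ (G u z) (G v z) ⟩
      G v z                        ∎

    G₂-v : ∀ {z} → z ≢ v → G₂ v z ≡ G v z xor G u z
    G₂-v z≢v = trans (localComp-centre G₁ v G₁-vv (≢-sym z≢v)) (localComp-nbr G u uv (≢-sym z≢v))

  pivot-sym : Symmetric pivot
  pivot-sym = localComp-sym (localComp-sym (localComp-sym symG u) v) u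

  pivot-diag : ∀ x → pivot x x ≡ G x x
  pivot-diag x = trans (localComp-diag G₂ u x) (trans (localComp-diag G₁ v x) (localComp-diag G u x))

  pivot-uv : pivot u v ≡ true
  pivot-uv = trans (localComp-centre G₂ u G₂-uu u≢v) G₂-uv

  pivot-u : ∀ {z} → z ≢ u → z ≢ v → pivot u z ≡ G v z
  pivot-u z≢u z≢v = trans (localComp-centre G₂ u G₂-uu (≢-sym z≢u)) (G₂-u z≢u z≢v)

  pivot-v : ∀ {z} → z ≢ u → z ≢ v → pivot v z ≡ G u z
  pivot-v {z} z≢u z≢v = begin
    pivot v z                     ≡⟨ localComp-nbr G₂ u G₂-uv (≢-sym z≢v) ⟩
    G₂ v z xor G₂ u z             ≡⟨ cong₂ _xor_ (G₂-v z≢v) (G₂-u z≢u z≢v) ⟩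
    (G v z xor G u z) xor G v z   ≡⟨ xor-cancelʳ (G v z) (G u z) ⟩
    G u z                         ∎

  pivot-off : ∀ {x y} → x ≢ u → x ≢ v → y ≢ u → y ≢ v →
    pivot x y ≡ G x y xor ((G u x ∧ G v y) xor (G v x ∧ G u y))
  pivot-off {x} {y} x≢u x≢v y≢u y≢v = by-equality (x ≟ y)
    where
    by-equality : Dec (x ≡ y) → pivot x y ≡ G x y xor ((G u x ∧ G v y) xor (G v x ∧ G u y))
    by-equality (yes refl) = trans (pivot-diag x) (sym (toggle-diag (G x x) (G u x) (G v x)))
    by-equality (no x≢y) = begin
      pivot x y                                             ≡⟨ localComp-off G₂ u x≢y ⟩
      G₂ x y xor (G₂ u x ∧ G₂ u y)                          ≡⟨ cong₂ _xor_ (localComp-off G₁ v x≢y)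
                                                                 (cong₂ _∧_ (G₂-u x≢u x≢v) (G₂-u y≢u y≢v)) ⟩
      (G₁ x y xor (G₁ v x ∧ G₁ v y)) xor (G v x ∧ G v y)    ≡⟨ cong (_xor (G v x ∧ G v y))
                                                                 (cong₂ _xor_ (localComp-off G u x≢y)
                                                                   (cong₂ _∧_ (localComp-nbr G u uv (≢-sym x≢v))
                                                                              (localComp-nbr G u uv (≢-sym y≢v)))) ⟩
      ((G x y xor (G u x ∧ G u y)) xor ((G v x xor G u x) ∧ (G v y xor G u y))) xor (G v x ∧ G v y)
                                                            ≡⟨ pivot-identity (G x y) (G u x) (G u y) (G v x) (G v y) ⟩
      G x y xor ((G u x ∧ G v y) xor (G v x ∧ G u y))       ∎

-- Vertices of the half graph and of the intermediate graphs:
-- aₖ = (k , false) and bₖ = (k , true).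
Vertex : Set
Vertex = ℕ × Bool

eqVertex : DecidableEquality Vertex
eqVertex = ×.≡-dec ℕ._≟_ Bool._≟_

open LocalComplementation eqVertex using (localComps-cong; localComps-++)

module BooleanComparisons where

  true-if-T : ∀ {b} → T b → b ≡ true
  true-if-T {true} _ = refl

  false-if-¬T : ∀ {b} → ¬ T b → b ≡ false
  false-if-¬T {false} _  = refl
  false-if-¬T {true}  ¬t = ⊥-elim (¬t _)

  <ᵇ-true : ∀ {m n} → m < n → (m <ᵇ n) ≡ true
  <ᵇ-true m<n = true-if-T (ℕ.<⇒<ᵇ m<n)

  <ᵇ-false : ∀ {m n} → n ≤ m → (m <ᵇ n) ≡ false
  <ᵇ-false {m} {n} n≤m = false-if-¬T (λ t → ℕ.<⇒≱ (ℕ.<ᵇ⇒< m n t) n≤m)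

  ≤ᵇ-true : ∀ {m n} → m ≤ n → (m ≤ᵇ n) ≡ true
  ≤ᵇ-true m≤n = true-if-T (ℕ.≤⇒≤ᵇ m≤n)

  ≤ᵇ-false : ∀ {m n} → n < m → (m ≤ᵇ n) ≡ false
  ≤ᵇ-false {m} {n} n<m = false-if-¬T (λ t → ℕ.<⇒≱ n<m (ℕ.≤ᵇ⇒≤ m n t))

  ≡ᵇ-refl : ∀ n → (n ≡ᵇ n) ≡ true
  ≡ᵇ-refl n = true-if-T (ℕ.≡⇒≡ᵇ n n refl)

  ≡ᵇ-false : ∀ {m n} → m ≢ n → (m ≡ᵇ n) ≡ false
  ≡ᵇ-false {m} {n} m≢n = false-if-¬T (λ t → m≢n (ℕ.≡ᵇ⇒≡ m n t))

  ⌊≟⌋-≡ᵇ : ∀ m n → ⌊ m ℕ.≟ n ⌋ ≡ (m ≡ᵇ n)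
  ⌊≟⌋-≡ᵇ m n with m ℕ.≟ n
  ... | yes refl = sym (≡ᵇ-refl m)
  ... | no m≢n   = sym (≡ᵇ-false m≢n)

open BooleanComparisons

data Position (j k : ℕ) : Set where
  below : k < j → Position j k
  above : j < k → Position j k

position : ∀ {j k} → k ≢ j → Position j k
position {j} {k} k≢j with ℕ.<-cmp k j
... | tri< k<j _ _ = below k<j
... | tri≈ _ k≡j _ = ⊥-elim (k≢j k≡j)
... | tri> _ _ j<k = above j<k

-- Stage j of the pivoting process.  It is bipartite: for k < j the vertex bₖ
-- is a row and aₖ a column, for k ≥ j it is the other way round.  A row of
-- index r and a column of index c are adjacent as given by `rowCol j r c`:
--   r , c < j   : c ∈ {r , r + 1}  (the path a₀ b₀ a₁ b₁ … built so far),
--   r < j ≤ c   : r + 1 = j        (its last vertex sees all later bₖ),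
--   c < j ≤ r   : never,
--   j ≤ r , c   : r ≤ c            (the untouched half graph).
isRow : ℕ → Vertex → Bool
isRow j (k , s) = if k <ᵇ j then s else not s

pathStep : ℕ → ℕ → Bool
pathStep r c = (r ≡ᵇ c) ∨ (suc r ≡ᵇ c)

rowCol : ℕ → ℕ → ℕ → Bool
rowCol j r c =
  if r <ᵇ j then (if c <ᵇ j then pathStep r c else (suc r ≡ᵇ j))
  else (if c <ᵇ j then false else (r ≤ᵇ c))

stage : ℕ → Graph Vertex
stage j (k , s) (l , t) =
  if isRow j (k , s) then (if isRow j (l , t) then false else rowCol j k l)
  else (if isRow j (l , t) then rowCol j l k else false)

stage-sym : ∀ j → Symmetric (stage j)
stage-sym j (k , s) (l , t) with isRow j (k , s) | isRow j (l , t)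
... | true  | true  = refl
... | true  | false = refl
... | false | true  = refl
... | false | false = refl

stage-loopless : ∀ j x → stage j x x ≡ false
stage-loopless j (k , s) with isRow j (k , s)
... | true  = refl
... | false = refl

stage-ab : ∀ j → stage j (j , false) (j , true) ≡ true
stage-ab j rewrite <ᵇ-false (ℕ.≤-refl {j}) | ≤ᵇ-true (ℕ.≤-refl {j}) = refl

stage-b→a : ∀ j l t → l ≢ j → stage j (j , true) (l , t) ≡ stage (suc j) (j , false) (l , t)
stage-b→a j l t l≢j rewrite <ᵇ-false (ℕ.≤-refl {j}) | <ᵇ-true (ℕ.n<1+n j) with position l≢j | t
... | below l<j | false rewrite <ᵇ-true l<j | <ᵇ-true (ℕ.m<n⇒m<1+n l<j) = refl
... | below l<j | true  rewrite <ᵇ-true l<j | <ᵇ-true (ℕ.m<n⇒m<1+n l<j) | ≡ᵇ-false l≢j = refl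
... | above j<l | false rewrite <ᵇ-false (ℕ.<⇒≤ j<l) | <ᵇ-false j<l | ≤ᵇ-false j<l = refl
... | above j<l | true  rewrite <ᵇ-false (ℕ.<⇒≤ j<l) | <ᵇ-false j<l = refl

stage-a→b : ∀ j l t → l ≢ j → stage j (j , false) (l , t) ≡ stage (suc j) (j , true) (l , t)
stage-a→b j l t l≢j rewrite <ᵇ-false (ℕ.≤-refl {j}) | <ᵇ-true (ℕ.n<1+n j) with position l≢j | t
... | below l<j | false rewrite <ᵇ-true l<j | <ᵇ-true (ℕ.m<n⇒m<1+n l<j)
                              | ≡ᵇ-false (≢-sym l≢j) | ≡ᵇ-false (ℕ.<⇒≢ (ℕ.m<n⇒m<1+n l<j) ∘ sym) = refl
... | below l<j | true  rewrite <ᵇ-true l<j | <ᵇ-true (ℕ.m<n⇒m<1+n l<j) = refl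
... | above j<l | false rewrite <ᵇ-false (ℕ.<⇒≤ j<l) | <ᵇ-false j<l = refl
... | above j<l | true  rewrite <ᵇ-false (ℕ.<⇒≤ j<l) | <ᵇ-false j<l | ≤ᵇ-true (ℕ.<⇒≤ j<l) | ≡ᵇ-refl j = refl

stage-off : ∀ j k s l t → k ≢ j → l ≢ j →
  stage (suc j) (k , s) (l , t) ≡ stage j (k , s) (l , t) xor
    ((stage j (j , false) (k , s) ∧ stage j (j , true) (l , t)) xor
     (stage j (j , true) (k , s) ∧ stage j (j , false) (l , t)))
stage-off j k s l t k≢j l≢j rewrite <ᵇ-false (ℕ.≤-refl {j}) with position k≢j | position l≢j
... | below k<j | below l<j
  rewrite <ᵇ-true k<j | <ᵇ-true (ℕ.m<n⇒m<1+n k<j) | <ᵇ-true l<j | <ᵇ-true (ℕ.m<n⇒m<1+n l<j)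
  with s | t
...   | false | false = refl
...   | false | true  = sym (xor-identityʳ _)
...   | true  | false rewrite ∧-zeroʳ (suc k ≡ᵇ j) = sym (xor-identityʳ _)
...   | true  | true  rewrite ∧-zeroʳ (suc k ≡ᵇ j) = refl
stage-off j k s l t k≢j l≢j | below k<j | above j<l
  rewrite <ᵇ-true k<j | <ᵇ-true (ℕ.m<n⇒m<1+n k<j) | <ᵇ-false (ℕ.<⇒≤ j<l) | <ᵇ-false j<l
        | ≡ᵇ-false k≢j | ≤ᵇ-true (ℕ.<⇒≤ j<l) | ≤ᵇ-false j<l
  with s | t
...   | false | false = refl
...   | false | true  = refl
...   | true  | false rewrite ∧-zeroʳ (suc k ≡ᵇ j) = refl
...   | true  | true  rewrite ∧-identityʳ (suc k ≡ᵇ j) = sym (xor-same (suc k ≡ᵇ j))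
stage-off j k s l t k≢j l≢j | above j<k | below l<j
  rewrite <ᵇ-true l<j | <ᵇ-true (ℕ.m<n⇒m<1+n l<j) | <ᵇ-false (ℕ.<⇒≤ j<k) | <ᵇ-false j<k
        | ≡ᵇ-false l≢j | ≤ᵇ-true (ℕ.<⇒≤ j<k) | ≤ᵇ-false j<k
  with s | t
...   | false | false = refl
...   | false | true  = refl
...   | true  | false = refl
...   | true  | true  rewrite xor-identityʳ (suc l ≡ᵇ j) = sym (xor-same (suc l ≡ᵇ j))
stage-off j k s l t k≢j l≢j | above j<k | above j<l
  rewrite <ᵇ-false (ℕ.<⇒≤ j<k) | <ᵇ-false j<k | <ᵇ-false (ℕ.<⇒≤ j<l) | <ᵇ-false j<l
        | ≤ᵇ-true (ℕ.<⇒≤ j<k) | ≤ᵇ-false j<k | ≤ᵇ-true (ℕ.<⇒≤ j<l) | ≤ᵇ-false j<l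
  with s | t
...   | false | false = refl
...   | false | true  = sym (xor-identityʳ _)
...   | true  | false = sym (xor-identityʳ _)
...   | true  | true  = refl

stage-ab-next : ∀ j → stage (suc j) (j , false) (j , true) ≡ true
stage-ab-next j rewrite <ᵇ-true (ℕ.n<1+n j) | ≡ᵇ-refl j = refl

module StagePivot (j : ℕ) =
  Pivot eqVertex (stage j) (stage-sym j) {j , false} {j , true} (λ ())
        (stage-ab j) (stage-loopless j (j , false)) (stage-loopless j (j , true))

avoid : ∀ {j k : ℕ} {s r : Bool} → k ≢ j → (k , s) ≢ (j , r)
avoid k≢j e = k≢j (cong proj₁ e)

pivot-stage-diag : ∀ j x → StagePivot.pivot j x x ≡ stage (suc j) x x
pivot-stage-diag j x = trans (StagePivot.pivot-diag j x) (trans (stage-loopless j x) (sym (stage-loopless (suc j) x)))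

pivot-stage-edge : ∀ j s t → StagePivot.pivot j (j , s) (j , t) ≡ stage (suc j) (j , s) (j , t)
pivot-stage-edge j false false = pivot-stage-diag j (j , false)
pivot-stage-edge j false true  = trans (StagePivot.pivot-uv j) (sym (stage-ab-next j))
pivot-stage-edge j true  false = trans (StagePivot.pivot-sym j (j , true) (j , false))
                                   (trans (pivot-stage-edge j false true) (stage-sym (suc j) (j , false) (j , true)))
pivot-stage-edge j true  true  = pivot-stage-diag j (j , true)

pivot-stage-end : ∀ j s l t → l ≢ j → StagePivot.pivot j (j , s) (l , t) ≡ stage (suc j) (j , s) (l , t)
pivot-stage-end j false l t l≢j = trans (StagePivot.pivot-u j (avoid l≢j) (avoid l≢j)) (stage-b→a j l t l≢j)
pivot-stage-end j true  l t l≢j = trans (StagePivot.pivot-v j (avoid l≢j) (avoid l≢j)) (stage-a→b j l t l≢j)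

pivot-stage : ∀ j → StagePivot.pivot j ≈ stage (suc j)
pivot-stage j (k , s) (l , t) with k ℕ.≟ j | l ℕ.≟ j
... | yes refl | yes refl = pivot-stage-edge j s t
... | yes refl | no l≢j   = pivot-stage-end j s l t l≢j
... | no k≢j   | yes refl = trans (StagePivot.pivot-sym j (k , s) (j , t))
                              (trans (pivot-stage-end j t k s k≢j) (stage-sym (suc j) (j , t) (k , s)))
... | no k≢j   | no l≢j   = trans (StagePivot.pivot-off j (avoid k≢j) (avoid k≢j) (avoid l≢j) (avoid l≢j))
                              (sym (stage-off j k s l t k≢j l≢j))

pivotsAlong : {X : Set} → List X → List (X × Bool)
pivotsAlong []       = []
pivotsAlong (k ∷ ks) = (k , false) ∷ (k , true) ∷ (k , false) ∷ pivotsAlong ks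

pivotsAlong-++ : {X : Set} (ks ls : List X) → pivotsAlong (ks ++ ls) ≡ pivotsAlong ks ++ pivotsAlong ls
pivotsAlong-++ []       ls = refl
pivotsAlong-++ (k ∷ ks) ls = cong (λ ps → (k , false) ∷ (k , true) ∷ (k , false) ∷ ps) (pivotsAlong-++ ks ls)

pivotsAlong-map : {X Y : Set} (f : X → Y) (ks : List X) →
  map (map₁ f) (pivotsAlong ks) ≡ pivotsAlong (map f ks)
pivotsAlong-map f []       = refl
pivotsAlong-map f (k ∷ ks) = cong (λ ps → (f k , false) ∷ (f k , true) ∷ (f k , false) ∷ ps) (pivotsAlong-map f ks)

pivots-stage : ∀ j → localComps eqVertex (stage 0) (pivotsAlong (upTo j)) ≈ stage j
pivots-stage zero    x y = refl
pivots-stage (suc j) x y = begin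
  localComps eqVertex (stage 0) (pivotsAlong (upTo (suc j))) x y
    ≡⟨ cong (λ ps → localComps eqVertex (stage 0) ps x y)
            (trans (cong pivotsAlong (sym (upTo-∷ʳ j))) (pivotsAlong-++ (upTo j) (j ∷ []))) ⟩
  localComps eqVertex (stage 0) (pivotsAlong (upTo j) ++ pivotsAlong (j ∷ [])) x y
    ≡⟨ cong (λ G → G x y) (localComps-++ (stage 0) (pivotsAlong (upTo j)) (pivotsAlong (j ∷ []))) ⟩
  localComps eqVertex (localComps eqVertex (stage 0) (pivotsAlong (upTo j))) (pivotsAlong (j ∷ [])) x y
    ≡⟨ localComps-cong (pivots-stage j) (pivotsAlong (j ∷ [])) x y ⟩
  StagePivot.pivot j x y
    ≡⟨ pivot-stage j x y ⟩
  stage (suc j) x y ∎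
  where open ≡-Reasoning

halfGraph : Bool → Graph Vertex
halfGraph d (k , false) (l , false) = false
halfGraph d (k , false) (l , true)  = k ≤ᵇ l
halfGraph d (k , true)  (l , false) = l ≤ᵇ k
halfGraph d (k , true)  (l , true)  = d ∧ not (k ≡ᵇ l)

halfGraph-stage₀ : halfGraph false ≈ stage 0
halfGraph-stage₀ (k , false) (l , false) = refl
halfGraph-stage₀ (k , false) (l , true)  = refl
halfGraph-stage₀ (k , true)  (l , false) = refl
halfGraph-stage₀ (k , true)  (l , true)  = refl

-- Local complementation at a₀, which is adjacent to every bₖ, removes the clique.
halfGraph-unclique : localComp eqVertex (halfGraph true) (0 , false) ≈ halfGraph false
halfGraph-unclique (k , false) (l , false) = refl
halfGraph-unclique (k , false) (l , true)  = xor-identityʳ (k ≤ᵇ l)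
halfGraph-unclique (k , true)  (l , false) = xor-identityʳ (l ≤ᵇ k)
halfGraph-unclique (k , true)  (l , true)
  rewrite ⌊⌋-⇔ (mk⇔ (cong proj₁) (cong (_, true))) (eqVertex (k , true) (l , true)) (k ℕ.≟ l)
        | ⌊≟⌋-≡ᵇ k l = xor-same (not (k ≡ᵇ l))

unclique : {X : Set} → Bool → X → List X
unclique true  x = x ∷ []
unclique false x = []

unclique-map : {X Y : Set} (f : X → Y) (d : Bool) (x : X) → map f (unclique d x) ≡ unclique d (f x)
unclique-map f true  x = refl
unclique-map f false x = refl

halfGraph-stage : ∀ d n →
  localComps eqVertex (halfGraph d) (unclique d (0 , false) ++ pivotsAlong (upTo n)) ≈ stage n
halfGraph-stage d n x y =
  trans (cong (λ G → G x y) (localComps-++ (halfGraph d) (unclique d (0 , false)) (pivotsAlong (upTo n))))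
        (trans (localComps-cong (unclique-stage₀ d) (pivotsAlong (upTo n)) x y) (pivots-stage n x y))
  where
  unclique-stage₀ : ∀ d → localComps eqVertex (halfGraph d) (unclique d (0 , false)) ≈ stage 0
  unclique-stage₀ true  x y = trans (halfGraph-unclique x y) (halfGraph-stage₀ x y)
  unclique-stage₀ false     = halfGraph-stage₀

longPath : Graph Vertex
longPath (k , false) (l , false) = false
longPath (k , false) (l , true)  = pathStep l k
longPath (k , true)  (l , false) = pathStep k l
longPath (k , true)  (l , true)  = false

stage-final : ∀ {n} x y → proj₁ x < n → proj₁ y < n → stage n x y ≡ longPath x y
stage-final (k , s) (l , t) k<n l<n rewrite <ᵇ-true k<n | <ᵇ-true l<n with s | t
... | false | false = refl
... | false | true  = refl
... | true  | false = refl
... | true  | true  = refl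

pathGraph : ℕ → ℕ → Bool
pathGraph i j = (suc i ≡ᵇ j) ∨ (suc j ≡ᵇ i)

double : ℕ → ℕ
double zero    = zero
double (suc k) = suc (suc (double k))

pathIndex : Vertex → ℕ
pathIndex (k , false) = double k
pathIndex (k , true)  = suc (double k)

pathVertex : ℕ → Vertex
pathVertex zero          = (0 , false)
pathVertex (suc zero)    = (0 , true)
pathVertex (suc (suc i)) = map₁ suc (pathVertex i)

pathIndex-pathVertex : ∀ i → pathIndex (pathVertex i) ≡ i
pathIndex-pathVertex zero          = refl
pathIndex-pathVertex (suc zero)    = refl
pathIndex-pathVertex (suc (suc i)) = trans (next (pathVertex i)) (cong (suc ∘ suc) (pathIndex-pathVertex i))
  where
  next : ∀ x → pathIndex (map₁ suc x) ≡ suc (suc (pathIndex x))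
  next (k , false) = refl
  next (k , true)  = refl

pathVertex-≤ : ∀ i → proj₁ (pathVertex i) ≤ i
pathVertex-≤ zero          = z≤n
pathVertex-≤ (suc zero)    = z≤n
pathVertex-≤ (suc (suc i)) = s≤s (ℕ.m≤n⇒m≤1+n (pathVertex-≤ i))

longPath-pathIndex : ∀ x y → longPath x y ≡ pathGraph (pathIndex x) (pathIndex y)
longPath-pathIndex (zero  , false) (zero  , false) = refl
longPath-pathIndex (zero  , false) (zero  , true)  = refl
longPath-pathIndex (zero  , true)  (zero  , false) = refl
longPath-pathIndex (zero  , true)  (zero  , true)  = refl
longPath-pathIndex (zero  , false) (suc l , false) = refl
longPath-pathIndex (zero  , false) (suc l , true)  = refl
longPath-pathIndex (zero  , true)  (suc zero , false)    = refl
longPath-pathIndex (zero  , true)  (suc (suc l) , false) = refl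
longPath-pathIndex (zero  , true)  (suc l , true)  = refl
longPath-pathIndex (suc k , false) (zero  , false) = refl
longPath-pathIndex (suc zero , false)    (zero , true) = refl
longPath-pathIndex (suc (suc k) , false) (zero , true) = refl
longPath-pathIndex (suc k , true)  (zero  , false) = refl
longPath-pathIndex (suc k , true)  (zero  , true)  = refl
longPath-pathIndex (suc k , false) (suc l , false) = longPath-pathIndex (k , false) (l , false)
longPath-pathIndex (suc k , false) (suc l , true)  = longPath-pathIndex (k , false) (l , true)
longPath-pathIndex (suc k , true)  (suc l , false) = longPath-pathIndex (k , true)  (l , false)
longPath-pathIndex (suc k , true)  (suc l , true)  = longPath-pathIndex (k , true)  (l , true)

FinVertex : ℕ → Set
FinVertex n = Fin n × Bool

eqFinVertex : {n : ℕ} → DecidableEquality (FinVertex n)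
eqFinVertex = ×.≡-dec Fin._≟_ Bool._≟_

toVertex : {n : ℕ} → FinVertex n → Vertex
toVertex = map₁ toℕ

toVertex-injective : {n : ℕ} → Injective _≡_ _≡_ (toVertex {n})
toVertex-injective e = cong₂ _,_ (Fin.toℕ-injective (cong proj₁ e)) (cong proj₂ e)

halfGraphFin : (n : ℕ) → Bool → Graph (FinVertex n)
halfGraphFin n d a b = halfGraph d (toVertex a) (toVertex b)

pathVertex-< : {n : ℕ} (i : Fin n) → proj₁ (pathVertex (toℕ i)) < n
pathVertex-< i = ℕ.≤-<-trans (pathVertex-≤ (toℕ i)) (Fin.toℕ<n i)

pathVertexFin : {n : ℕ} → Fin n → FinVertex n
pathVertexFin i = fromℕ< (pathVertex-< i) , proj₂ (pathVertex (toℕ i))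

toVertex-pathVertexFin : {n : ℕ} (i : Fin n) → toVertex (pathVertexFin i) ≡ pathVertex (toℕ i)
toVertex-pathVertexFin i = cong (_, proj₂ (pathVertex (toℕ i))) (Fin.toℕ-fromℕ< _)

pathVertexFin-injective : {n : ℕ} → Injective _≡_ _≡_ (pathVertexFin {n})
pathVertexFin-injective {x = i} {j} e = Fin.toℕ-injective (begin
  toℕ i                                        ≡⟨ sym (pathIndex-pathVertex (toℕ i)) ⟩
  pathIndex (pathVertex (toℕ i))               ≡⟨ cong pathIndex (sym (toVertex-pathVertexFin i)) ⟩
  pathIndex (toVertex (pathVertexFin i))       ≡⟨ cong (pathIndex ∘ toVertex) e ⟩
  pathIndex (toVertex (pathVertexFin j))       ≡⟨ cong pathIndex (toVertex-pathVertexFin j) ⟩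
  pathIndex (pathVertex (toℕ j))               ≡⟨ pathIndex-pathVertex (toℕ j) ⟩
  toℕ j                                        ∎)
  where open ≡-Reasoning

allFin-upTo : ∀ n → map toℕ (allFin n) ≡ upTo n
allFin-upTo n = trans (map-tabulate (λ i → i) toℕ) (tabulate-applyUpTo n (λ k → k))
  where
  tabulate-applyUpTo : {A : Set} (n : ℕ) (f : ℕ → A) → tabulate {n = n} (f ∘ toℕ) ≡ applyUpTo f n
  tabulate-applyUpTo zero    f = refl
  tabulate-applyUpTo (suc n) f = cong (f 0 ∷_) (tabulate-applyUpTo n (f ∘ suc))

halfGraphFin-path : ∀ m d → HasVertexMinorIso eqFinVertex (halfGraphFin (suc m) d) (P (suc m))
halfGraphFin-path m d = ws , pathVertexFin , pathVertexFin-injective , path≡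
  where
  n = suc m
  open InducedSubgraph eqVertex eqFinVertex toVertex toVertex-injective
  open ≡-Reasoning

  ws : List (FinVertex n)
  ws = unclique d (fzero , false) ++ pivotsAlong (allFin n)

  ws-image : map toVertex ws ≡ unclique d (0 , false) ++ pivotsAlong (upTo n)
  ws-image = trans (map-++ toVertex (unclique d (fzero , false)) (pivotsAlong (allFin n)))
    (cong₂ _++_ (unclique-map toVertex d (fzero , false))
                (trans (pivotsAlong-map toℕ (allFin n)) (cong pivotsAlong (allFin-upTo n))))

  path≡ : ∀ i j → P n i j ≡ localComps eqFinVertex (halfGraphFin n d) ws (pathVertexFin i) (pathVertexFin j)
  path≡ i j = begin
    pathGraph (toℕ i) (toℕ j)
      ≡⟨ sym (cong₂ pathGraph (pathIndex-pathVertex (toℕ i)) (pathIndex-pathVertex (toℕ j))) ⟩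
    pathGraph (pathIndex (pathVertex (toℕ i))) (pathIndex (pathVertex (toℕ j)))
      ≡⟨ sym (longPath-pathIndex (pathVertex (toℕ i)) (pathVertex (toℕ j))) ⟩
    longPath (pathVertex (toℕ i)) (pathVertex (toℕ j))
      ≡⟨ sym (stage-final (pathVertex (toℕ i)) (pathVertex (toℕ j)) (pathVertex-< i) (pathVertex-< j)) ⟩
    stage n (pathVertex (toℕ i)) (pathVertex (toℕ j))
      ≡⟨ sym (halfGraph-stage d n (pathVertex (toℕ i)) (pathVertex (toℕ j))) ⟩
    localComps eqVertex (halfGraph d) (unclique d (0 , false) ++ pivotsAlong (upTo n))
      (pathVertex (toℕ i)) (pathVertex (toℕ j))
      ≡⟨ cong (λ vs → localComps eqVertex (halfGraph d) vs (pathVertex (toℕ i)) (pathVertex (toℕ j)))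
              (sym ws-image) ⟩
    localComps eqVertex (halfGraph d) (map toVertex ws) (pathVertex (toℕ i)) (pathVertex (toℕ j))
      ≡⟨ sym (cong₂ (localComps eqVertex (halfGraph d) (map toVertex ws))
                    (toVertex-pathVertexFin i) (toVertex-pathVertexFin j)) ⟩
    localComps eqVertex (halfGraph d) (map toVertex ws) (toVertex (pathVertexFin i)) (toVertex (pathVertexFin j))
      ≡⟨ sym (localComps-restrict (λ _ _ → refl) ws (pathVertexFin i) (pathVertexFin j)) ⟩
    localComps eqFinVertex (halfGraphFin n d) ws (pathVertexFin i) (pathVertexFin j) ∎

byOrder : ℕ → ℕ → Bool → Bool → Bool → Bool
byOrder k l e lt gt = if k ≡ᵇ l then e else (if k <ᵇ l then lt else gt)

byOrder-≡ : ∀ k {e lt gt} → byOrder k k e lt gt ≡ e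
byOrder-≡ k rewrite ≡ᵇ-refl k = refl

byOrder-< : ∀ {k l e lt gt} → k < l → byOrder k l e lt gt ≡ lt
byOrder-< k<l rewrite ≡ᵇ-false (ℕ.<⇒≢ k<l) | <ᵇ-true k<l = refl

byOrder-> : ∀ {k l e lt gt} → l < k → byOrder k l e lt gt ≡ gt
byOrder-> l<k rewrite ≡ᵇ-false (ℕ.<⇒≢ l<k ∘ sym) | <ᵇ-false (ℕ.<⇒≤ l<k) = refl

byOrder-elim : (Q : Bool → Set) (k l : ℕ) {e lt gt : Bool} →
  (k ≡ l → Q e) → (k < l → Q lt) → (l < k → Q gt) → Q (byOrder k l e lt gt)
byOrder-elim Q k l q≡ q< q> with ℕ.<-cmp k l
... | tri< k<l _ _ = subst Q (sym (byOrder-< k<l)) (q< k<l)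
... | tri≈ _ refl _ = subst Q (sym (byOrder-≡ k)) (q≡ refl)
... | tri> _ _ l<k = subst Q (sym (byOrder-> l<k)) (q> l<k)

byOrder-const : ∀ k l x → byOrder k l x x x ≡ x
byOrder-const k l x = byOrder-elim (_≡ x) k l (λ _ → refl) (λ _ → refl) (λ _ → refl)

byOrder-≤ : ∀ k l → byOrder k l true true false ≡ (k ≤ᵇ l)
byOrder-≤ k l = byOrder-elim (_≡ (k ≤ᵇ l)) k l
  (λ { refl → sym (≤ᵇ-true (ℕ.≤-refl {k})) }) (λ k<l → sym (≤ᵇ-true (ℕ.<⇒≤ k<l))) (λ l<k → sym (≤ᵇ-false l<k))

byOrder-≥ : ∀ k l → byOrder k l true false true ≡ (l ≤ᵇ k)
byOrder-≥ k l = byOrder-elim (_≡ (l ≤ᵇ k)) k l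
  (λ { refl → sym (≤ᵇ-true (ℕ.≤-refl {k})) }) (λ k<l → sym (≤ᵇ-false k<l)) (λ l<k → sym (≤ᵇ-true (ℕ.<⇒≤ l<k)))

byOrder-≢ : ∀ k l x → byOrder k l false x x ≡ x ∧ not (k ≡ᵇ l)
byOrder-≢ k l x = byOrder-elim (_≡ x ∧ not (k ≡ᵇ l)) k l
  (λ { refl → sym (trans (cong (λ b → x ∧ not b) (≡ᵇ-refl k)) (∧-zeroʳ x)) })
  (λ k<l → sym (trans (cong (λ b → x ∧ not b) (≡ᵇ-false (ℕ.<⇒≢ k<l))) (∧-identityʳ x)))
  (λ l<k → sym (trans (cong (λ b → x ∧ not b) (≡ᵇ-false (ℕ.<⇒≢ l<k ∘ sym))) (∧-identityʳ x)))

byOrder-<suc : ∀ k l → byOrder k (suc l) false true false ≡ (k ≤ᵇ l)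
byOrder-<suc k l = byOrder-elim (_≡ (k ≤ᵇ l)) k (suc l)
  (λ { refl → sym (≤ᵇ-false (ℕ.n<1+n l)) })
  (λ k<1+l → sym (≤ᵇ-true (ℕ.≤-pred k<1+l)))
  (λ 1+l<k → sym (≤ᵇ-false (ℕ.<-trans (ℕ.n<1+n l) 1+l<k)))

byOrder-suc> : ∀ k l → byOrder (suc k) l false false true ≡ (l ≤ᵇ k)
byOrder-suc> k l = byOrder-elim (_≡ (l ≤ᵇ k)) (suc k) l
  (λ { refl → sym (≤ᵇ-false (ℕ.n<1+n k)) })
  (λ 1+k<l → sym (≤ᵇ-false (ℕ.<-trans (ℕ.n<1+n k) 1+k<l)))
  (λ l<1+k → sym (≤ᵇ-true (ℕ.≤-pred l<1+k)))

PowerVertex : ℕ → Set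
PowerVertex s = Fin s × (Fin 1 ⊎ Fin 1)

intoEq : {n : ℕ} → FinVertex n → PowerVertex n
intoEq (k , false) = k , inj₁ fzero
intoEq (k , true)  = k , inj₂ fzero

intoEq-injective : {n : ℕ} → Injective _≡_ _≡_ (intoEq {n})
intoEq-injective {x = k , false} {l , false} refl = refl
intoEq-injective {x = k , true}  {l , true}  refl = refl

halfGraph-in-⊕₌ : ∀ n d (x y : FinVertex n) →
  halfGraphFin n d x y ≡ power (oplusEq K1 K1) n false true false d (intoEq x) (intoEq y)
halfGraph-in-⊕₌ n d (k , false) (l , false) = sym (byOrder-const (toℕ k) (toℕ l) false)
halfGraph-in-⊕₌ n d (k , false) (l , true)  = sym (byOrder-≤ (toℕ k) (toℕ l))
halfGraph-in-⊕₌ n d (k , true)  (l , false) = sym (byOrder-≥ (toℕ k) (toℕ l))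
halfGraph-in-⊕₌ n d (k , true)  (l , true)  = sym (byOrder-≢ (toℕ k) (toℕ l) d)

intoNeq : {n : ℕ} → FinVertex n → PowerVertex (suc n)
intoNeq (k , false) = inject₁ k , inj₁ fzero
intoNeq (k , true)  = fsuc k , inj₂ fzero

intoNeq-injective : {n : ℕ} → Injective _≡_ _≡_ (intoNeq {n})
intoNeq-injective {x = k , false} {l , false} e = cong (_, false) (Fin.inject₁-injective (cong proj₁ e))
intoNeq-injective {x = k , true}  {l , true}  refl = refl

halfGraph-in-⊕≠ : ∀ n d (x y : FinVertex n) →
  halfGraphFin n d x y ≡ power (oplusNeq K1 K1) (suc n) false true false d (intoNeq x) (intoNeq y)
halfGraph-in-⊕≠ n d (k , false) (l , false) = sym (byOrder-const (toℕ (inject₁ k)) (toℕ (inject₁ l)) false)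
halfGraph-in-⊕≠ n d (k , false) (l , true)  rewrite Fin.toℕ-inject₁ k = sym (byOrder-<suc (toℕ k) (toℕ l))
halfGraph-in-⊕≠ n d (k , true)  (l , false) rewrite Fin.toℕ-inject₁ l = sym (byOrder-suc> (toℕ k) (toℕ l))
halfGraph-in-⊕≠ n d (k , true)  (l , true)  = sym (byOrder-≢ (toℕ k) (toℕ l) d)

reverse : {s m : ℕ} → Fin s × (Fin m ⊎ Fin m) → Fin s × (Fin m ⊎ Fin m)
reverse = map₁ opposite

reverse-injective : {s m : ℕ} → Injective _≡_ _≡_ (reverse {s} {m})
reverse-injective {x = k , u} {l , w} e =
  cong₂ _,_ (trans (sym (Fin.opposite-involutive k))
                   (trans (cong (opposite ∘ proj₁) e) (Fin.opposite-involutive l)))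
            (cong proj₂ e)

opposite-< : ∀ {s} {k l : Fin s} → toℕ k < toℕ l → toℕ (opposite l) < toℕ (opposite k)
opposite-< {s} {k} {l} k<l rewrite Fin.opposite-prop k | Fin.opposite-prop l =
  ℕ.∸-monoʳ-< (s≤s k<l) (Fin.toℕ<n l)

sideAdj-transpose : ∀ {m} a b c d (u w : Fin m ⊎ Fin m) → sideAdj a b c d u w ≡ sideAdj a c b d w u
sideAdj-transpose a b c d (inj₁ _) (inj₁ _) = refl
sideAdj-transpose a b c d (inj₁ _) (inj₂ _) = refl
sideAdj-transpose a b c d (inj₂ _) (inj₁ _) = refl
sideAdj-transpose a b c d (inj₂ _) (inj₂ _) = refl

power-reverse : ∀ {m} (X : Graph (Fin m ⊎ Fin m)) s a b c d (k l : Fin s) u w →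
  power X s a b c d (opposite k , u) (opposite l , w) ≡ power X s a c b d (k , u) (l , w)
power-reverse X s a b c d k l u w with ℕ.<-cmp (toℕ k) (toℕ l)
... | tri< k<l _ _ =
  trans (byOrder-> (opposite-< k<l)) (trans (sideAdj-transpose a b c d w u) (sym (byOrder-< k<l)))
... | tri≈ _ k≡l _ rewrite Fin.toℕ-injective {i = k} {j = l} k≡l =
  trans (byOrder-≡ (toℕ (opposite l))) (sym (byOrder-≡ (toℕ l)))
... | tri> _ _ l<k =
  trans (byOrder-< (opposite-< l<k)) (trans (sideAdj-transpose a b c d u w) (sym (byOrder-> l<k)))

transpose-vertexMinor : ∀ {m} {X : Graph (Fin m ⊎ Fin m)} {s a b c d} {U : Set} {K : Graph U} →
  HasVertexMinorIso _≟V_ (power X s a c b d) K → HasVertexMinorIso _≟V_ (power X s a b c d) K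
transpose-vertexMinor {X = X} {s} {a} {b} {c} {d} =
  vertexMinor-lift (λ { (k , u) (l , w) → sym (power-reverse X s a b c d k l u w) })
  where open InducedSubgraph _≟V_ _≟V_ reverse reverse-injective

upper-triangular : ∀ m d →
  HasVertexMinorIso _≟V_ (power (oplusEq K1 K1) (suc m) false true false d) (P (suc m))
  × HasVertexMinorIso _≟V_ (power (oplusNeq K1 K1) (suc (suc m)) false true false d) (P (suc m))
upper-triangular m d =
  InducedSubgraph.vertexMinor-lift _≟V_ eqFinVertex intoEq intoEq-injective
    (halfGraph-in-⊕₌ (suc m) d) (halfGraphFin-path m d) ,
  InducedSubgraph.vertexMinor-lift _≟V_ eqFinVertex intoNeq intoNeq-injective
    (halfGraph-in-⊕≠ (suc m) d) (halfGraphFin-path m d)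

-- Lemma 4.11.  The bound n ≥ 2 is only used to exclude n = 0.
lemma4p11 : (n : ℕ) → 2 ≤ n → (b c d : Bool) → b ≢ c →
    HasVertexMinorIso _≟V_ (power (oplusEq K1 K1) n false b c d) (P n)
    × HasVertexMinorIso _≟V_ (power (oplusNeq K1 K1) (suc n) false b c d) (P n)
lemma4p11 zero    ()
lemma4p11 (suc m) _ true  false d _   = upper-triangular m d
lemma4p11 (suc m) _ false true  d _   = map-× transpose-vertexMinor transpose-vertexMinor (upper-triangular m d)
lemma4p11 (suc m) _ true  true  d b≢c = ⊥-elim (b≢c refl)
lemma4p11 (suc m) _ false false d b≢c = ⊥-elim (b≢c refl)
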